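{- Let $n\equiv 3\pmod 4$ be a positive integer. Then the path $P_n$, regarded as a signed graph, is determined by its spectrum if and only if $n=3$.
   Context: A signed graph $\Gamma=(G,\sigma)$ is a simple graph $G=(V,E)$ together with a map $\sigma:E\to\{ -1,+1\}$. Its adjacency matrix is obtained from the $(0,1)$-adjacency matrix of $G$ by replacing the entry $1$ by $-1$ for each negative edge; the spectrum of $\Gamma$ is the spectrum of this matrix. Two signed graphs are cospectral if they have the same spectrum. Switching with respect to a vertex subset $X$ changes the sign of every edge with exactly one end in $X$. Two signed graphs are switching isomorphic if one can be switched into a signed graph isomorphic to the other. A signed graph $\Gamma$ is determined by its spectrum if every signed graph cospectral with $\Gamma$ is switching isomorphic with $\Gamma$. The path $P_n$ is regarded as a signed graph with all edges positive. -}

module Defs where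

open import Data.Nat using (ℕ; zero; suc; ∣_-_∣)
open import Data.Nat.Properties using (∣-∣-comm; m≡n⇒∣m-n∣≡0)
open import Data.Integer using (ℤ; +_; -[1+_]; _+_; _*_; -_)
open import Data.Fin using (Fin; zero; suc; toℕ; punchIn; _≟_)
open import Data.Bool using (Bool; true; false; _xor_; if_then_else_)
open import Data.List using (List; []; _∷_; map; foldr)
open import Data.Product using (Σ; ∃; _,_; _×_)
open import Function.Bundles using (_↔_; Inverse)
open import Relation.Nullary using (yes; no; Dec)
open import Relation.Nullary.Decidable using (does)
open import Relation.Binary.PropositionalEquality using (_≡_; refl; sym; cong)
import Data.Nat as ℕ

data Edge : Set where
  none pos neg : Edge

entry : Edge → ℤ
entry none = + 0
entry pos  = + 1
entry neg  = -[1+ 0 ]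

record SignedGraph (n : ℕ) : Set where
  field
    adj      : Fin n → Fin n → Edge
    adj-sym  : ∀ i j → adj i j ≡ adj j i
    loopless : ∀ i → adj i i ≡ none
open SignedGraph public

adjMatrix : ∀ {n} → SignedGraph n → Fin n → Fin n → ℤ
adjMatrix Γ i j = entry (adj Γ i j)

edgeOfDist : ℕ → Edge
edgeOfDist d with d ℕ.≟ 1
... | yes _ = pos
... | no  _ = none

pathEdge : ℕ → ℕ → Edge
pathEdge a b = edgeOfDist ∣ a - b ∣

pathEdge-sym : ∀ a b → pathEdge a b ≡ pathEdge b a
pathEdge-sym a b = cong edgeOfDist (∣-∣-comm a b)

pathEdge-loop : ∀ a → pathEdge a a ≡ none
pathEdge-loop a = cong edgeOfDist (m≡n⇒∣m-n∣≡0 {a} {a} refl)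

path : (n : ℕ) → SignedGraph n
path n = record
  { adj      = λ i j → pathEdge (toℕ i) (toℕ j)
  ; adj-sym  = λ i j → pathEdge-sym (toℕ i) (toℕ j)
  ; loopless = λ i → pathEdge-loop (toℕ i)
  }

negateEdge : Edge → Edge
negateEdge none = none
negateEdge pos  = neg
negateEdge neg  = pos

flipIf : Bool → Edge → Edge
flipIf true  e = negateEdge e
flipIf false e = e

switchAdj : ∀ {n} → (Fin n → Bool) → SignedGraph n → Fin n → Fin n → Edge
switchAdj X Γ i j = flipIf (X i xor X j) (adj Γ i j)

SwitchingIsomorphic : ∀ {n} → SignedGraph n → SignedGraph n → Set
SwitchingIsomorphic {n} Γ Δ =
  Σ (Fin n → Bool) λ X →
  Σ (Fin n ↔ Fin n) λ π →
    ∀ i j → adj Δ (Inverse.to π i) (Inverse.to π j) ≡ switchAdj X Γ i j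

-- Polynomials over ℤ as coefficient lists (constant term first)

Poly : Set
Poly = List ℤ

infixl 6 _+P_
infixl 7 _*P_

_+P_ : Poly → Poly → Poly
[]      +P q       = q
(a ∷ p) +P []      = a ∷ p
(a ∷ p) +P (b ∷ q) = (a + b) ∷ (p +P q)

scaleP : ℤ → Poly → Poly
scaleP a = map (a *_)

_*P_ : Poly → Poly → Poly
[]      *P q = []
(a ∷ p) *P q = scaleP a q +P (+ 0 ∷ (p *P q))

constP : ℤ → Poly
constP a = a ∷ []

Xpoly : Poly
Xpoly = + 0 ∷ + 1 ∷ []

cons0 : ℤ → Poly → Poly
cons0 (+ zero) [] = []
cons0 a        q  = a ∷ q

normP : Poly → Poly
normP []      = []
normP (a ∷ p) = cons0 a (normP p)

_≈P_ : Poly → Poly → Set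
p ≈P q = normP p ≡ normP q

sumP : List Poly → Poly
sumP = foldr _+P_ []

allFinL : (n : ℕ) → List (Fin n)
allFinL zero    = []
allFinL (suc n) = zero ∷ map suc (allFinL n)

signℕ : ℕ → ℤ
signℕ zero          = + 1
signℕ (suc zero)    = -[1+ 0 ]
signℕ (suc (suc k)) = signℕ k

det : ∀ {n} → (Fin n → Fin n → Poly) → Poly
det {zero}  M = constP (+ 1)
det {suc n} M =
  sumP (map (λ j → constP (signℕ (toℕ j)) *P M zero j
                    *P det (λ i k → M (suc i) (punchIn j k)))
            (allFinL (suc n)))

charPoly : ∀ {n} → SignedGraph n → Poly
charPoly {n} Γ = det (λ i j →
  (if does (i ≟ j) then Xpoly else []) +P constP (- adjMatrix Γ i j))

-- Two signed graphs (of the same order) are cospectral iff their adjacency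
-- matrices have the same spectrum (with multiplicities), i.e. the same
-- characteristic polynomial.
Cospectral : ∀ {n} → SignedGraph n → SignedGraph n → Set
Cospectral Γ Δ = charPoly Γ ≈P charPoly Δ

DeterminedBySpectrum : ∀ {n} → SignedGraph n → Set
DeterminedBySpectrum {n} Γ =
  (Δ : SignedGraph n) → Cospectral Γ Δ → SwitchingIsomorphic Γ Δ

-- If r is a pendant vertex of a signed graph G with neighbour y, expanding
-- det(xI - A) along r gives Schwenk's formula φ(G) = x φ(G - r) - φ(G - r - y).  Iterating it, a path with k vertices hanging from y
-- contributes p_{k+1} φ(H) - p_k φ(H - y), where p_{k+1} = φ(P_k) obeys
-- p_{k+2} = x p_{k+1} - p_k.  For n = 4t + 7 take the disjoint union of P_{t+1}
-- and an unbalanced quadrangle (characteristic polynomial (x² - 2)²) with paths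
-- of t and 2t + 2 vertices hanging from two opposite corners.  Its
-- characteristic polynomial factors as
--   p_{t+2} (p_{t+3} - p_{t+1}) (p_{2t+5} - p_{2t+3}),
-- and p_{j+2} (p_{j+3} - p_{j+1}) = p_{2j+4} turns this into p_{4t+8} = φ(P_n).
-- The corner carrying the long path has degree 3, which no switching of a path
-- has.  For n = 3 all 27 signed graphs on three vertices are checked.

module Submission where

open import Defs
open import Algebra.Bundles using (CommutativeRing)
import Algebra.Consequences.Setoid as Consequences
open import Data.Bool using (Bool; true; false; _xor_; if_then_else_)
open import Data.Empty using (⊥-elim)
open import Data.Fin using (Fin; zero; suc; toℕ; punchIn; opposite; fromℕ<; _≟_)
open import Data.Fin.Properties using (toℕ-injective; toℕ<n; toℕ-fromℕ; toℕ-fromℕ<; opposite-prop; opposite-involutive; opposite-suc; all?)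
import Data.Fin.Permutation as Permutation
open import Data.Integer using (ℤ; +_; +[1+_]; -[1+_]; -_) renaming (_+_ to _+ℤ_; _*_ to _*ℤ_)
import Data.Integer.Properties as ℤ
open import Algebra.Properties.CommutativeSemigroup ℤ.+-commutativeSemigroup using (x∙yz≈y∙xz)
open import Data.List using (List; []; _∷_; _++_; length; map; tabulate; applyDownFrom; cartesianProduct)
open import Data.List.Properties using (length-++-sucʳ; map-∘; map-cong; tabulate-cong; ++-identityʳ; ++-assoc)
open import Data.List.Membership.Propositional using (_∈_)
open import Data.List.Relation.Unary.All as All using (All; []; _∷_)
import Data.List.Relation.Unary.All.Properties as All
open import Data.List.Relation.Unary.Any using (Any; here; there; any?; satisfied)
open import Data.Maybe using (Maybe; just; nothing)
open import Data.Nat using (ℕ; zero; suc; _+_; _*_; _<_; _≤_; z≤n; s≤s; ∣_-_∣; _%_; _/_)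
import Data.Nat as ℕ
open import Data.Nat.DivMod using (m≡m%n+[m/n]*n)
open import Data.Nat.Properties
  using (<-cmp; <-irrefl; <-asym; <-trans; <-≤-trans; ≤-<-trans; ≤-trans; <⇒≢; >⇒≢; n<1+n; m≤m+n; m<m+n;
         +-monoʳ-<; +-identityʳ; +-suc; +-assoc; suc-injective; ∣m+n-m+o∣≡∣n-o∣; ∣-∣-comm; m∸n+n≡m)
import Data.Nat.Tactic.RingSolver as ℕ-Solver
open import Data.Product using (Σ; _×_; _,_; proj₁; proj₂)
open import Data.Sum using (_⊎_; inj₁; inj₂; [_,_]′)
open import Data.Unit using (⊤; tt)
open import Function using (_∘_)
open import Function.Bundles using (_↔_; _⇔_; Inverse; mk⇔)
open import Relation.Binary.Bundles using (Setoid)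
open import Relation.Binary.Definitions using (DecidableEquality; tri<; tri≈; tri>)
open import Relation.Binary.Structures using (IsEquivalence)
open import Relation.Nullary using (¬_; Dec; yes; no)
open import Relation.Nullary.Decidable using (does; dec-true; dec-false; True; toWitness)
open import Relation.Binary.PropositionalEquality
import Relation.Binary.Reasoning.Setoid as SetoidReasoning
open import Tactic.RingSolver using (solve-∀)
import Tactic.RingSolver.Core.AlmostCommutativeRing as Solver

coeff : Poly → ℕ → ℤ
coeff []      _       = + 0
coeff (a ∷ p) zero    = a
coeff (a ∷ p) (suc k) = coeff p k

infix 4 _≋_

-- Coefficientwise equality; unlike _≈P_ it is visibly a congruence.
record _≋_ (p q : Poly) : Set where
  constructor mk≋
  field coeff-≡ : ∀ k → coeff p k ≡ coeff q k
open _≋_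

≋-refl : ∀ {p} → p ≋ p
≋-refl = mk≋ λ _ → refl

≋-sym : ∀ {p q} → p ≋ q → q ≋ p
≋-sym p≋q = mk≋ λ k → sym (coeff-≡ p≋q k)

≋-trans : ∀ {p q r} → p ≋ q → q ≋ r → p ≋ r
≋-trans p≋q q≋r = mk≋ λ k → trans (coeff-≡ p≋q k) (coeff-≡ q≋r k)

≋-isEquivalence : IsEquivalence _≋_
≋-isEquivalence = record { refl = ≋-refl ; sym = ≋-sym ; trans = ≋-trans }

≋-setoid : Setoid _ _
≋-setoid = record { isEquivalence = ≋-isEquivalence }

module ≋-Reasoning = SetoidReasoning ≋-setoid

negP : Poly → Poly
negP = scaleP -[1+ 0 ]

infixl 6 _-P_

_-P_ : Poly → Poly → Poly
p -P q = p +P negP q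

1P : Poly
1P = constP (+ 1)

coeff-+P : ∀ p q k → coeff (p +P q) k ≡ coeff p k +ℤ coeff q k
coeff-+P []      q       k       = sym (ℤ.+-identityˡ _)
coeff-+P (a ∷ p) []      k       = sym (ℤ.+-identityʳ _)
coeff-+P (a ∷ p) (b ∷ q) zero    = refl
coeff-+P (a ∷ p) (b ∷ q) (suc k) = coeff-+P p q k

coeff-scaleP : ∀ a p k → coeff (scaleP a p) k ≡ a *ℤ coeff p k
coeff-scaleP a []      k       = sym (ℤ.*-zeroʳ a)
coeff-scaleP a (b ∷ p) zero    = refl
coeff-scaleP a (b ∷ p) (suc k) = coeff-scaleP a p k

∷-cong : ∀ a {p q} → p ≋ q → a ∷ p ≋ a ∷ q
∷-cong a p≋q = mk≋ λ { zero → refl ; (suc k) → coeff-≡ p≋q k }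

0∷[]≋[] : + 0 ∷ [] ≋ []
0∷[]≋[] = mk≋ λ { zero → refl ; (suc k) → refl }

+P-cong : ∀ {p p′ q q′} → p ≋ p′ → q ≋ q′ → p +P q ≋ p′ +P q′
+P-cong {p} {p′} {q} {q′} p≋p′ q≋q′ = mk≋ λ k → begin
  coeff (p +P q) k          ≡⟨ coeff-+P p q k ⟩
  coeff p k +ℤ coeff q k    ≡⟨ cong₂ _+ℤ_ (coeff-≡ p≋p′ k) (coeff-≡ q≋q′ k) ⟩
  coeff p′ k +ℤ coeff q′ k  ≡⟨ coeff-+P p′ q′ k ⟨
  coeff (p′ +P q′) k        ∎
  where open ≡-Reasoning

scaleP-cong : ∀ a {p q} → p ≋ q → scaleP a p ≋ scaleP a q
scaleP-cong a {p} {q} p≋q = mk≋ λ k → begin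
  coeff (scaleP a p) k  ≡⟨ coeff-scaleP a p k ⟩
  a *ℤ coeff p k        ≡⟨ cong (a *ℤ_) (coeff-≡ p≋q k) ⟩
  a *ℤ coeff q k        ≡⟨ coeff-scaleP a q k ⟨
  coeff (scaleP a q) k  ∎
  where open ≡-Reasoning

negP-cong : ∀ {p q} → p ≋ q → negP p ≋ negP q
negP-cong = scaleP-cong -[1+ 0 ]

-P-cong : ∀ {p p′ q q′} → p ≋ p′ → q ≋ q′ → p -P q ≋ p′ -P q′
-P-cong p≋p′ q≋q′ = +P-cong p≋p′ (negP-cong q≋q′)

+P-comm : ∀ p q → p +P q ≋ q +P p
+P-comm p q = mk≋ λ k → begin
  coeff (p +P q) k        ≡⟨ coeff-+P p q k ⟩
  coeff p k +ℤ coeff q k  ≡⟨ ℤ.+-comm (coeff p k) (coeff q k) ⟩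
  coeff q k +ℤ coeff p k  ≡⟨ coeff-+P q p k ⟨
  coeff (q +P p) k        ∎
  where open ≡-Reasoning

+P-assoc : ∀ p q r → (p +P q) +P r ≋ p +P (q +P r)
+P-assoc p q r = mk≋ λ k → begin
  coeff ((p +P q) +P r) k                ≡⟨ coeff-+P (p +P q) r k ⟩
  coeff (p +P q) k +ℤ coeff r k          ≡⟨ cong (_+ℤ coeff r k) (coeff-+P p q k) ⟩
  coeff p k +ℤ coeff q k +ℤ coeff r k    ≡⟨ ℤ.+-assoc (coeff p k) (coeff q k) (coeff r k) ⟩
  coeff p k +ℤ (coeff q k +ℤ coeff r k)  ≡⟨ cong (_+ℤ_ (coeff p k)) (coeff-+P q r k) ⟨
  coeff p k +ℤ coeff (q +P r) k          ≡⟨ coeff-+P p (q +P r) k ⟨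
  coeff (p +P (q +P r)) k                ∎
  where open ≡-Reasoning

+P-identityʳ : ∀ p → p +P [] ≋ p
+P-identityʳ p = mk≋ λ k → trans (coeff-+P p [] k) (ℤ.+-identityʳ (coeff p k))

negP-inverseʳ : ∀ p → p +P negP p ≋ []
negP-inverseʳ p = mk≋ λ k → begin
  coeff (p +P negP p) k               ≡⟨ coeff-+P p (negP p) k ⟩
  coeff p k +ℤ coeff (negP p) k       ≡⟨ cong (_+ℤ_ (coeff p k)) (coeff-scaleP -[1+ 0 ] p k) ⟩
  coeff p k +ℤ -[1+ 0 ] *ℤ coeff p k  ≡⟨ cong (_+ℤ_ (coeff p k)) (ℤ.-1*i≡-i (coeff p k)) ⟩
  coeff p k +ℤ - coeff p k            ≡⟨ ℤ.+-inverseʳ (coeff p k) ⟩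
  + 0                                 ∎
  where open ≡-Reasoning

scaleP-distribˡ : ∀ a p q → scaleP a (p +P q) ≋ scaleP a p +P scaleP a q
scaleP-distribˡ a p q = mk≋ λ k → begin
  coeff (scaleP a (p +P q)) k                   ≡⟨ coeff-scaleP a (p +P q) k ⟩
  a *ℤ coeff (p +P q) k                         ≡⟨ cong (a *ℤ_) (coeff-+P p q k) ⟩
  a *ℤ (coeff p k +ℤ coeff q k)                 ≡⟨ ℤ.*-distribˡ-+ a (coeff p k) (coeff q k) ⟩
  a *ℤ coeff p k +ℤ a *ℤ coeff q k              ≡⟨ cong₂ _+ℤ_ (coeff-scaleP a p k) (coeff-scaleP a q k) ⟨
  coeff (scaleP a p) k +ℤ coeff (scaleP a q) k  ≡⟨ coeff-+P (scaleP a p) (scaleP a q) k ⟨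
  coeff (scaleP a p +P scaleP a q) k            ∎
  where open ≡-Reasoning

scaleP-distribʳ : ∀ a b p → scaleP (a +ℤ b) p ≋ scaleP a p +P scaleP b p
scaleP-distribʳ a b p = mk≋ λ k → begin
  coeff (scaleP (a +ℤ b) p) k                   ≡⟨ coeff-scaleP (a +ℤ b) p k ⟩
  (a +ℤ b) *ℤ coeff p k                         ≡⟨ ℤ.*-distribʳ-+ (coeff p k) a b ⟩
  a *ℤ coeff p k +ℤ b *ℤ coeff p k              ≡⟨ cong₂ _+ℤ_ (coeff-scaleP a p k) (coeff-scaleP b p k) ⟨
  coeff (scaleP a p) k +ℤ coeff (scaleP b p) k  ≡⟨ coeff-+P (scaleP a p) (scaleP b p) k ⟨
  coeff (scaleP a p +P scaleP b p) k            ∎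
  where open ≡-Reasoning

scaleP-assoc : ∀ a b p → scaleP a (scaleP b p) ≋ scaleP (a *ℤ b) p
scaleP-assoc a b p = mk≋ λ k → begin
  coeff (scaleP a (scaleP b p)) k  ≡⟨ coeff-scaleP a (scaleP b p) k ⟩
  a *ℤ coeff (scaleP b p) k        ≡⟨ cong (a *ℤ_) (coeff-scaleP b p k) ⟩
  a *ℤ (b *ℤ coeff p k)            ≡⟨ ℤ.*-assoc a b (coeff p k) ⟨
  a *ℤ b *ℤ coeff p k              ≡⟨ coeff-scaleP (a *ℤ b) p k ⟨
  coeff (scaleP (a *ℤ b) p) k      ∎
  where open ≡-Reasoning

scaleP-zero : ∀ p → scaleP (+ 0) p ≋ []
scaleP-zero p = mk≋ λ k → trans (coeff-scaleP (+ 0) p k) (ℤ.*-zeroˡ (coeff p k))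

scaleP-identity : ∀ p → scaleP (+ 1) p ≋ p
scaleP-identity p = mk≋ λ k → trans (coeff-scaleP (+ 1) p k) (ℤ.*-identityˡ (coeff p k))

*P-congʳ : ∀ p {q q′} → q ≋ q′ → p *P q ≋ p *P q′
*P-congʳ []      q≋q′ = ≋-refl
*P-congʳ (a ∷ p) q≋q′ = +P-cong (scaleP-cong a q≋q′) (∷-cong (+ 0) (*P-congʳ p q≋q′))

*P-zeroʳ : ∀ p → p *P [] ≋ []
*P-zeroʳ []      = ≋-refl
*P-zeroʳ (a ∷ p) = ≋-trans (∷-cong (+ 0) (*P-zeroʳ p)) 0∷[]≋[]

*P-cons : ∀ p b q → p *P (b ∷ q) ≋ scaleP b p +P (+ 0 ∷ p *P q)
*P-cons []      b q = ≋-sym 0∷[]≋[]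
*P-cons (a ∷ p) b q = mk≋ λ
  { zero    → cong (λ c → c +ℤ + 0) (ℤ.*-comm a b)
  ; (suc k) → begin
      coeff (scaleP a q +P p *P (b ∷ q)) k
        ≡⟨ coeff-+P (scaleP a q) _ k ⟩
      aq k +ℤ coeff (p *P (b ∷ q)) k
        ≡⟨ cong (aq k +ℤ_) (trans (coeff-≡ (*P-cons p b q) k) (coeff-+P (scaleP b p) _ k)) ⟩
      aq k +ℤ (bp k +ℤ pq k)
        ≡⟨ x∙yz≈y∙xz (aq k) (bp k) (pq k) ⟩
      bp k +ℤ (aq k +ℤ pq k)
        ≡⟨ cong (bp k +ℤ_) (coeff-+P (scaleP a q) _ k) ⟨
      bp k +ℤ coeff ((a ∷ p) *P q) k
        ≡⟨ coeff-+P (scaleP b p) _ k ⟨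
      coeff (scaleP b p +P (a ∷ p) *P q) k
        ∎ }
  where
  open ≡-Reasoning
  aq bp pq : ℕ → ℤ
  aq k = coeff (scaleP a q) k
  bp k = coeff (scaleP b p) k
  pq k = coeff (+ 0 ∷ p *P q) k

*P-comm : ∀ p q → p *P q ≋ q *P p
*P-comm []      q = ≋-sym (*P-zeroʳ q)
*P-comm (a ∷ p) q = ≋-trans (+P-cong ≋-refl (∷-cong (+ 0) (*P-comm p q))) (≋-sym (*P-cons q a p))

*P-cong : ∀ {p p′ q q′} → p ≋ p′ → q ≋ q′ → p *P q ≋ p′ *P q′
*P-cong {p} {p′} {q} {q′} p≋p′ q≋q′ =
  ≋-trans (*P-comm p q) (≋-trans (*P-congʳ q p≋p′) (≋-trans (*P-comm q p′) (*P-congʳ p′ q≋q′)))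

*P-distribʳ : ∀ r p q → (p +P q) *P r ≋ p *P r +P q *P r
*P-distribʳ r []      q       = ≋-refl
*P-distribʳ r (a ∷ p) []      = ≋-sym (+P-identityʳ _)
*P-distribʳ r (a ∷ p) (b ∷ q) = ≋-trans
  (+P-cong (scaleP-distribʳ a b r) (∷-cong (+ 0) (*P-distribʳ r p q)))
  (Consequences.comm∧assoc⇒middleFour ≋-setoid +P-cong +P-comm +P-assoc
     (scaleP a r) (scaleP b r) (+ 0 ∷ p *P r) (+ 0 ∷ q *P r))

scaleP-*P : ∀ a p q → scaleP a p *P q ≋ scaleP a (p *P q)
scaleP-*P a []      q = ≋-refl
scaleP-*P a (b ∷ p) q = ≋-trans
  (+P-cong (≋-sym (scaleP-assoc a b q))
           (≋-trans (∷-cong (+ 0) (scaleP-*P a p q)) (mk≋ λ { zero → sym (ℤ.*-zeroʳ a) ; (suc k) → refl })))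
  (≋-sym (scaleP-distribˡ a (scaleP b q) (+ 0 ∷ p *P q)))

0∷-*P : ∀ p q → (+ 0 ∷ p) *P q ≋ + 0 ∷ p *P q
0∷-*P p q = +P-cong (scaleP-zero q) ≋-refl

*P-assoc : ∀ p q r → (p *P q) *P r ≋ p *P (q *P r)
*P-assoc []      q r = ≋-refl
*P-assoc (a ∷ p) q r = ≋-trans (*P-distribʳ r (scaleP a q) (+ 0 ∷ p *P q))
  (+P-cong (scaleP-*P a q r) (≋-trans (0∷-*P (p *P q) r) (∷-cong (+ 0) (*P-assoc p q r))))

*P-identityˡ : ∀ p → 1P *P p ≋ p
*P-identityˡ p = ≋-trans (+P-cong (scaleP-identity p) 0∷[]≋[]) (+P-identityʳ p)

polyCommutativeRing : CommutativeRing _ _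
polyCommutativeRing = record
  { Carrier = Poly ; _≈_ = _≋_ ; _+_ = _+P_ ; _*_ = _*P_ ; -_ = negP ; 0# = [] ; 1# = 1P
  ; isCommutativeRing = record
    { isRing = record
      { +-isAbelianGroup = record
        { isGroup = record
          { isMonoid = record
            { isSemigroup = record
              { isMagma = record { isEquivalence = ≋-isEquivalence ; ∙-cong = +P-cong }
              ; assoc = +P-assoc }
            ; identity = (λ _ → ≋-refl) , +P-identityʳ }
          ; inverse = comm∧invʳ⇒inv +P-comm negP-inverseʳ
          ; ⁻¹-cong = negP-cong }
        ; comm = +P-comm }
      ; *-cong = *P-cong
      ; *-assoc = *P-assoc
      ; *-identity = comm∧idˡ⇒id *P-comm *P-identityˡ
      ; distrib = comm∧distrʳ⇒distr +P-cong *P-comm *P-distribʳ }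
    ; *-comm = *P-comm } }
  where open Consequences ≋-setoid

coeff-cons0 : ∀ a q k → coeff (cons0 a q) k ≡ coeff (a ∷ q) k
coeff-cons0 (+ zero) []      zero    = refl
coeff-cons0 (+ zero) []      (suc k) = refl
coeff-cons0 (+ zero) (b ∷ q) k       = refl
coeff-cons0 +[1+ n ] q       k       = refl
coeff-cons0 -[1+ n ] q       k       = refl

coeff-normP : ∀ p k → coeff (normP p) k ≡ coeff p k
coeff-normP []      k       = refl
coeff-normP (a ∷ p) zero    = coeff-cons0 a (normP p) zero
coeff-normP (a ∷ p) (suc k) = trans (coeff-cons0 a (normP p) (suc k)) (coeff-normP p k)

≈P⇒≋ : ∀ {p q} → p ≈P q → p ≋ q
≈P⇒≋ {p} {q} eq = mk≋ λ k → begin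
  coeff p k          ≡⟨ coeff-normP p k ⟨
  coeff (normP p) k  ≡⟨ cong (λ r → coeff r k) eq ⟩
  coeff (normP q) k  ≡⟨ coeff-normP q k ⟩
  coeff q k          ∎
  where open ≡-Reasoning

normP-≋[] : ∀ p → p ≋ [] → normP p ≡ []
normP-≋[] []      _    = refl
normP-≋[] (a ∷ p) p≋[] rewrite normP-≋[] p (mk≋ λ k → coeff-≡ p≋[] (suc k)) | coeff-≡ p≋[] zero = refl

≋⇒≈P : ∀ {p q} → p ≋ q → p ≈P q
≋⇒≈P {[]}    {q}     p≋q = sym (normP-≋[] q (≋-sym p≋q))
≋⇒≈P {a ∷ p} {[]}    p≋q = normP-≋[] (a ∷ p) p≋q
≋⇒≈P {a ∷ p} {b ∷ q} p≋q rewrite coeff-≡ p≋q zero | ≋⇒≈P {p} {q} (mk≋ λ k → coeff-≡ p≋q (suc k)) = refl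

polyRing : Solver.AlmostCommutativeRing _ _
polyRing = Solver.fromCommutativeRing polyCommutativeRing isZero
  where
  isZero : ∀ p → Maybe ([] ≋ p)
  isZero p with normP p in eq
  ... | []    = just (≈P⇒≋ (sym eq))
  ... | _ ∷ _ = nothing

negP-*P : ∀ p q → negP p *P q ≋ negP (p *P q)
negP-*P p q = scaleP-*P -[1+ 0 ] p q

zero-*P : ∀ {p} q → p ≋ [] → p *P q ≋ []
zero-*P q p≋[] = *P-cong p≋[] (≋-refl {q})

*P-zero : ∀ p {q} → q ≋ [] → p *P q ≋ []
*P-zero p q≋[] = ≋-trans (*P-congʳ p q≋[]) (*P-zeroʳ p)

Matrix : Set
Matrix = ℕ → ℕ → Poly

-- alternatingSum G (c₀ ∷ … ∷ cₘ) = Σⱼ (-1)ʲ G cⱼ (the list with cⱼ removed)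
alternatingSum : (ℕ → List ℕ → Poly) → List ℕ → Poly
alternatingSum G []      = []
alternatingSum G (c ∷ C) = G c C -P alternatingSum (λ d D → G d (c ∷ D)) C

-- The determinant of the submatrix of F on rows R and columns C, expanded
-- along the first row; it is meaningful when length R ≡ length C.
minor : Matrix → List ℕ → List ℕ → Poly
minor F []      C = 1P
minor F (r ∷ R) C = alternatingSum (λ c C′ → F r c *P minor F R C′) C

-- P holds at every term of alternatingSum _ C.
AllPicks : (ℕ → List ℕ → Set) → List ℕ → Set
AllPicks P []      = ⊤
AllPicks P (c ∷ C) = P c C × AllPicks (λ d D → P d (c ∷ D)) C

allPicks : ∀ P C → (∀ pre d post → C ≡ pre ++ d ∷ post → P d (pre ++ post)) → AllPicks P C
allPicks P []      h = tt
allPicks P (c ∷ C) h = h [] c C refl , allPicks _ C (λ pre d post eq → h (c ∷ pre) d post (cong (c ∷_) eq))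

signP : ℕ → Poly
signP zero    = 1P
signP (suc k) = negP (signP k)

alternatingSum-cong : ∀ {G G′} C → AllPicks (λ d D → G d D ≋ G′ d D) C → alternatingSum G C ≋ alternatingSum G′ C
alternatingSum-cong []      _        = ≋-refl
alternatingSum-cong (c ∷ C) (h , hs) = -P-cong h (alternatingSum-cong C hs)

alternatingSum-zero : ∀ {G} C → AllPicks (λ d D → G d D ≋ []) C → alternatingSum G C ≋ []
alternatingSum-zero []      _        = ≋-refl
alternatingSum-zero (c ∷ C) (h , hs) = -P-cong h (alternatingSum-zero C hs)

private
  distrib-sub : ∀ k a b → k *P a -P k *P b ≋ k *P (a -P b)
  distrib-sub = solve-∀ polyRing

alternatingSum-scale : ∀ G k C → alternatingSum (λ d D → k *P G d D) C ≋ k *P alternatingSum G C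
alternatingSum-scale G k []      = ≋-sym (*P-zeroʳ k)
alternatingSum-scale G k (c ∷ C) = begin
  k *P G c C -P alternatingSum (λ d D → k *P G d (c ∷ D)) C  ≈⟨ -P-cong ≋-refl (alternatingSum-scale _ k C) ⟩
  k *P G c C -P k *P alternatingSum (λ d D → G d (c ∷ D)) C  ≈⟨ distrib-sub k _ _ ⟩
  k *P alternatingSum G (c ∷ C)                              ∎
  where open ≋-Reasoning

allPicks-All : ∀ {P : ℕ → Set} {Q : ℕ → List ℕ → Set} C → All P C → (∀ d D → P d → Q d D) → AllPicks Q C
allPicks-All []      []       f = tt
allPicks-All (c ∷ C) (p ∷ ps) f = f c C p , allPicks-All C ps (λ d D → f d (c ∷ D))

private
  sub-zero : ∀ a → a -P [] ≋ 1P *P a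
  sub-zero = solve-∀ polyRing

  zero-sub : ∀ s g → [] -P s *P g ≋ negP s *P g
  zero-sub = solve-∀ polyRing

alternatingSum-single : ∀ G C₁ y C₂ →
  All (λ d → ∀ D → G d D ≋ []) C₁ → All (λ d → ∀ D → G d D ≋ []) C₂ →
  alternatingSum G (C₁ ++ y ∷ C₂) ≋ signP (length C₁) *P G y (C₁ ++ C₂)
alternatingSum-single G []       y C₂ []       h₂ = begin
  G y C₂ -P alternatingSum (λ d D → G d (y ∷ D)) C₂
    ≈⟨ -P-cong ≋-refl (alternatingSum-zero C₂ (allPicks-All C₂ h₂ λ d D z → z (y ∷ D))) ⟩
  G y C₂ -P []                                       ≈⟨ sub-zero (G y C₂) ⟩
  1P *P G y C₂                                       ∎
  where open ≋-Reasoning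
alternatingSum-single G (c ∷ C₁) y C₂ (h ∷ h₁) h₂ = begin
  G c (C₁ ++ y ∷ C₂) -P alternatingSum (λ d D → G d (c ∷ D)) (C₁ ++ y ∷ C₂)
    ≈⟨ -P-cong (h _) (alternatingSum-single _ C₁ y C₂ (All.map (λ z D → z (c ∷ D)) h₁)
                                                       (All.map (λ z D → z (c ∷ D)) h₂)) ⟩
  [] -P signP (length C₁) *P G y (c ∷ C₁ ++ C₂)
    ≈⟨ zero-sub (signP (length C₁)) _ ⟩
  signP (suc (length C₁)) *P G y (c ∷ C₁ ++ C₂)
    ∎
  where open ≋-Reasoning

∈-++∷⁻ : ∀ {c : ℕ} pre d post → c ∈ pre ++ d ∷ post → c ≡ d ⊎ c ∈ pre ++ post
∈-++∷⁻ []        d post (here c≡d) = inj₁ c≡d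
∈-++∷⁻ []        d post (there c∈) = inj₂ c∈
∈-++∷⁻ (x ∷ pre) d post (here c≡x) = inj₂ (here c≡x)
∈-++∷⁻ (x ∷ pre) d post (there c∈) with ∈-++∷⁻ pre d post c∈
... | inj₁ c≡d = inj₁ c≡d
... | inj₂ c∈′ = inj₂ (there c∈′)

minor-zeroColumn : ∀ F R C c → length R ≡ length C → c ∈ C → All (λ r → F r c ≋ []) R → minor F R C ≋ []
minor-zeroColumn F []      (_ ∷ _) c () _ _
minor-zeroColumn F (r ∷ R) C       c |R|≡|C| c∈C (Frc≋0 ∷ col) = alternatingSum-zero C (allPicks _ C term≋0)
  where
  term≋0 : ∀ pre d post → C ≡ pre ++ d ∷ post → F r d *P minor F R (pre ++ post) ≋ []
  term≋0 pre d post refl with ∈-++∷⁻ pre d post c∈C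
  ... | inj₁ refl = zero-*P _ Frc≋0
  ... | inj₂ c∈′  = *P-zero (F r d) (minor-zeroColumn F R (pre ++ post) c
                      (suc-injective (trans |R|≡|C| (length-++-sucʳ pre d post))) c∈′ col)

private
  rearrange : ∀ a s f m → a *P (s *P (f *P m)) ≋ (s *P f) *P (a *P m)
  rearrange = solve-∀ polyRing

  zero-sub-assoc : ∀ s f m → [] -P (s *P f) *P m ≋ negP s *P (f *P m)
  zero-sub-assoc = solve-∀ polyRing

minor-column : ∀ F R₁ y R₂ c C → length (R₁ ++ R₂) ≡ length C →
  All (λ r → F r c ≋ []) R₁ → All (λ r → F r c ≋ []) R₂ →
  minor F (R₁ ++ y ∷ R₂) (c ∷ C) ≋ signP (length R₁) *P (F y c *P minor F (R₁ ++ R₂) C)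
minor-column F [] y R₂ c C |R₂|≡|C| [] col₂ = begin
  F y c *P minor F R₂ C -P alternatingSum (λ d D → F y d *P minor F R₂ (c ∷ D)) C
    ≈⟨ -P-cong ≋-refl (alternatingSum-zero C (allPicks _ C term≋0)) ⟩
  F y c *P minor F R₂ C -P []
    ≈⟨ sub-zero _ ⟩
  1P *P (F y c *P minor F R₂ C)
    ∎
  where
  open ≋-Reasoning
  term≋0 : ∀ pre d post → C ≡ pre ++ d ∷ post → F y d *P minor F R₂ (c ∷ pre ++ post) ≋ []
  term≋0 pre d post refl = *P-zero (F y d) (minor-zeroColumn F R₂ (c ∷ pre ++ post) c
                             (trans |R₂|≡|C| (length-++-sucʳ pre d post)) (here refl) col₂)
minor-column F (r ∷ R₁) y R₂ c C |R|≡|C| (Frc≋0 ∷ col₁) col₂ = begin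
  F r c *P minor F (R₁ ++ y ∷ R₂) C -P alternatingSum (λ d D → F r d *P minor F (R₁ ++ y ∷ R₂) (c ∷ D)) C
    ≈⟨ -P-cong (zero-*P _ Frc≋0) (alternatingSum-cong C (allPicks _ C expand)) ⟩
  [] -P alternatingSum (λ d D → (s *P F y c) *P (F r d *P minor F (R₁ ++ R₂) D)) C
    ≈⟨ -P-cong ≋-refl (alternatingSum-scale _ (s *P F y c) C) ⟩
  [] -P (s *P F y c) *P minor F (r ∷ R₁ ++ R₂) C
    ≈⟨ zero-sub-assoc s (F y c) _ ⟩
  negP s *P (F y c *P minor F (r ∷ R₁ ++ R₂) C)
    ∎
  where
  open ≋-Reasoning
  s = signP (length R₁)
  expand : ∀ pre d post → C ≡ pre ++ d ∷ post →
    F r d *P minor F (R₁ ++ y ∷ R₂) (c ∷ pre ++ post) ≋ (s *P F y c) *P (F r d *P minor F (R₁ ++ R₂) (pre ++ post))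
  expand pre d post refl = ≋-trans
    (*P-congʳ (F r d) (minor-column F R₁ y R₂ c (pre ++ post)
      (suc-injective (trans |R|≡|C| (length-++-sucʳ pre d post))) col₁ col₂))
    (rearrange (F r d) s (F y c) _)

private
  negP-square : ∀ s → negP s *P negP s ≋ s *P s
  negP-square = solve-∀ polyRing

  regroup : ∀ s a b m → s *P (a *P (s *P (b *P m))) ≋ (s *P s) *P ((a *P b) *P m)
  regroup = solve-∀ polyRing

  unit-unit : ∀ m → 1P *P (1P *P m) ≋ m
  unit-unit = solve-∀ polyRing

signP-square : ∀ k → signP k *P signP k ≋ 1P
signP-square zero    = ≋-refl
signP-square (suc k) = ≋-trans (negP-square (signP k)) (signP-square k)

minor-pendant : ∀ F r R₁ y R₂ → F r r ≋ Xpoly →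
  All (λ z → F r z ≋ [] × F z r ≋ []) (R₁ ++ R₂) → F r y *P F y r ≋ 1P →
  minor F (r ∷ R₁ ++ y ∷ R₂) (r ∷ R₁ ++ y ∷ R₂)
    ≋ Xpoly *P minor F (R₁ ++ y ∷ R₂) (R₁ ++ y ∷ R₂) -P minor F (R₁ ++ R₂) (R₁ ++ R₂)
minor-pendant F r R₁ y R₂ Frr≋X zeros FryFyr≋1 = begin
  F r r *P minor F R R -P alternatingSum (λ d D → F r d *P minor F R (r ∷ D)) R
    ≈⟨ -P-cong (*P-cong Frr≋X ≋-refl) (alternatingSum-single _ R₁ y R₂ (rowZero zeros₁) (rowZero zeros₂)) ⟩
  Xpoly *P minor F R R -P s *P (F r y *P minor F R (r ∷ R₁ ++ R₂))
    ≈⟨ -P-cong ≋-refl (*P-congʳ s (*P-congʳ (F r y)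
         (minor-column F R₁ y R₂ r (R₁ ++ R₂) refl (All.map proj₂ zeros₁) (All.map proj₂ zeros₂)))) ⟩
  Xpoly *P minor F R R -P s *P (F r y *P (s *P (F y r *P minor F (R₁ ++ R₂) (R₁ ++ R₂))))
    ≈⟨ -P-cong ≋-refl (≋-trans (regroup s (F r y) (F y r) _)
         (≋-trans (*P-cong (signP-square (length R₁)) (*P-cong FryFyr≋1 ≋-refl)) (unit-unit _))) ⟩
  Xpoly *P minor F R R -P minor F (R₁ ++ R₂) (R₁ ++ R₂)
    ∎
  where
  open ≋-Reasoning
  R = R₁ ++ y ∷ R₂
  s = signP (length R₁)
  zeros₁ = All.++⁻ˡ R₁ zeros
  zeros₂ = All.++⁻ʳ R₁ zeros
  rowZero : ∀ {Z} → All (λ z → F r z ≋ [] × F z r ≋ []) Z → All (λ d → ∀ D → F r d *P minor F R (r ∷ D) ≋ []) Z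
  rowZero = All.map λ z D → zero-*P _ (proj₁ z)

minor-isolated : ∀ F r R → F r r ≋ Xpoly → All (λ z → F r z ≋ []) R →
  minor F (r ∷ R) (r ∷ R) ≋ Xpoly *P minor F R R
minor-isolated F r R Frr≋X zeros = begin
  F r r *P minor F R R -P alternatingSum (λ d D → F r d *P minor F R (r ∷ D)) R
    ≈⟨ -P-cong (*P-cong Frr≋X ≋-refl) (alternatingSum-zero R (allPicks-All R zeros λ d D z → zero-*P _ z)) ⟩
  Xpoly *P minor F R R -P []
    ≈⟨ ≋-trans (sub-zero _) (*P-identityˡ _) ⟩
  Xpoly *P minor F R R
    ∎
  where open ≋-Reasoning

minor-cong : ∀ {F F′} (P : ℕ → Set) → (∀ {a b} → P a → P b → F a b ≋ F′ a b) →
  ∀ {R C} → All P R → All P C → minor F R C ≋ minor F′ R C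
minor-cong         P F≋F′ {[]}    []        PC = ≋-refl
minor-cong {F} {F′} P F≋F′ {r ∷ R} {C} (Pr ∷ PR) PC = alternatingSum-cong C (allPicks _ C term≋)
  where
  term≋ : ∀ pre d post → C ≡ pre ++ d ∷ post → F r d *P minor F R (pre ++ post) ≋ F′ r d *P minor F′ R (pre ++ post)
  term≋ pre d post refl = *P-cong (F≋F′ Pr (All.head rest)) (minor-cong P F≋F′ PR (All.++⁺ (All.++⁻ˡ pre PC) (All.tail rest)))
    where rest = All.++⁻ʳ pre PC

sumP-cong : ∀ {A : Set} {f g : A → Poly} xs → (∀ x → f x ≋ g x) → sumP (map f xs) ≋ sumP (map g xs)
sumP-cong []       f≋g = ≋-refl
sumP-cong (x ∷ xs) f≋g = +P-cong (f≋g x) (sumP-cong xs f≋g)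

sumP-negP : ∀ {A : Set} (f : A → Poly) xs → sumP (map (negP ∘ f) xs) ≋ negP (sumP (map f xs))
sumP-negP f []       = ≋-refl
sumP-negP f (x ∷ xs) = ≋-trans (+P-cong ≋-refl (sumP-negP f xs)) (≋-sym (scaleP-distribˡ -[1+ 0 ] (f x) (sumP (map f xs))))

constP-signℕ-suc : ∀ m → constP (signℕ (suc m)) ≋ negP (constP (signℕ m))
constP-signℕ-suc m = mk≋ λ { zero → trans (signℕ-suc m) (sym (ℤ.-1*i≡-i (signℕ m))) ; (suc k) → refl }
  where
  signℕ-suc : ∀ m → signℕ (suc m) ≡ - signℕ m
  signℕ-suc zero          = refl
  signℕ-suc (suc zero)    = refl
  signℕ-suc (suc (suc m)) = signℕ-suc m

sumP-≋-alternatingSum : ∀ n (G : ℕ → List ℕ → Poly) (κ : Fin (suc n) → ℕ) →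
  sumP (map (λ j → constP (signℕ (toℕ j)) *P G (κ j) (tabulate (κ ∘ punchIn j))) (allFinL (suc n)))
    ≋ alternatingSum G (tabulate κ)
sumP-≋-alternatingSum zero    G κ = +P-cong (*P-identityˡ (G (κ zero) [])) ≋-refl
sumP-≋-alternatingSum (suc n) G κ = +P-cong (*P-identityˡ _) (begin
  sumP (map term (map suc (allFinL (suc n))))
    ≡⟨ cong sumP (map-∘ (allFinL (suc n))) ⟨
  sumP (map (term ∘ suc) (allFinL (suc n)))
    ≈⟨ sumP-cong (allFinL (suc n)) (λ j →
         ≋-trans (*P-cong (constP-signℕ-suc (toℕ j)) ≋-refl) (negP-*P (constP (signℕ (toℕ j))) _)) ⟩
  sumP (map (negP ∘ term′) (allFinL (suc n)))
    ≈⟨ sumP-negP term′ (allFinL (suc n)) ⟩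
  negP (sumP (map term′ (allFinL (suc n))))
    ≈⟨ negP-cong (sumP-≋-alternatingSum n (λ d D → G d (κ zero ∷ D)) (κ ∘ suc)) ⟩
  negP (alternatingSum (λ d D → G d (κ zero ∷ D)) (tabulate (κ ∘ suc)))
    ∎)
  where
  open ≋-Reasoning
  term : Fin (suc (suc n)) → Poly
  term j = constP (signℕ (toℕ j)) *P G (κ j) (tabulate (κ ∘ punchIn j))
  term′ : Fin (suc n) → Poly
  term′ j = constP (signℕ (toℕ j)) *P G (κ (suc j)) (κ zero ∷ tabulate (κ ∘ suc ∘ punchIn j))

det-≋-minor : ∀ n (M : Fin n → Fin n → Poly) F (ρ κ : Fin n → ℕ) →
  (∀ i j → M i j ≋ F (ρ i) (κ j)) → det M ≋ minor F (tabulate ρ) (tabulate κ)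
det-≋-minor zero    M F ρ κ M≋F = ≋-refl
det-≋-minor (suc n) M F ρ κ M≋F = ≋-trans
  (sumP-cong (allFinL (suc n)) λ j → ≋-trans (*P-assoc (sign j) (M zero j) _)
    (*P-congʳ (sign j) (*P-cong (M≋F zero j) (det-≋-minor n _ F (ρ ∘ suc) (κ ∘ punchIn j) λ i k → M≋F (suc i) (punchIn j k)))))
  (sumP-≋-alternatingSum n (λ d D → F (ρ zero) d *P minor F (tabulate (ρ ∘ suc)) D) κ)
  where
  sign : Fin (suc n) → Poly
  sign j = constP (signℕ (toℕ j))

-- A signed graph on ℕ given by the edges from each vertex to the lower ones.
symmetrize : (ℕ → ℕ → Edge) → ℕ → ℕ → Edge
symmetrize low a b with <-cmp a b
... | tri< _ _ _ = low b a
... | tri≈ _ _ _ = none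
... | tri> _ _ _ = low a b

symmetrize-> : ∀ low {a b} → b < a → symmetrize low a b ≡ low a b
symmetrize-> low {a} {b} b<a with <-cmp a b
... | tri< a<b _ _  = ⊥-elim (<-asym a<b b<a)
... | tri≈ _ refl _ = ⊥-elim (<-irrefl refl b<a)
... | tri> _ _ _    = refl

symmetrize-< : ∀ low {a b} → a < b → symmetrize low a b ≡ low b a
symmetrize-< low {a} {b} a<b with <-cmp a b
... | tri< _ _ _    = refl
... | tri≈ _ refl _ = ⊥-elim (<-irrefl refl a<b)
... | tri> _ _ b<a  = ⊥-elim (<-asym a<b b<a)

symmetrize-loop : ∀ low a → symmetrize low a a ≡ none
symmetrize-loop low a with <-cmp a a
... | tri< a<a _ _ = ⊥-elim (<-irrefl refl a<a)
... | tri≈ _ _ _   = refl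
... | tri> _ _ a<a = ⊥-elim (<-irrefl refl a<a)

symmetrize-sym : ∀ low a b → symmetrize low a b ≡ symmetrize low b a
symmetrize-sym low a b with <-cmp a b
... | tri< a<b _ _  = sym (symmetrize-> low a<b)
... | tri≈ _ refl _ = sym (symmetrize-loop low a)
... | tri> _ _ b<a  = sym (symmetrize-< low b<a)

charEntry : (ℕ → ℕ → Edge) → Matrix
charEntry g a b = (if does (a ℕ.≟ b) then Xpoly else []) +P constP (- entry (g a b))

-- The characteristic polynomial of the subgraph of g induced on the
-- (distinct) labels L.
charPolyOn : (ℕ → ℕ → Edge) → List ℕ → Poly
charPolyOn g L = minor (charEntry g) L L

charPoly-≋-charPolyOn : ∀ {n} (Γ : SignedGraph n) g (ρ : Fin n → ℕ) → (∀ {i j} → ρ i ≡ ρ j → i ≡ j) →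
  (∀ i j → adj Γ i j ≡ g (ρ i) (ρ j)) → charPoly Γ ≋ charPolyOn g (tabulate ρ)
charPoly-≋-charPolyOn {n} Γ g ρ ρ-injective adj≡g = det-≋-minor n _ (charEntry g) ρ ρ entry≡
  where
  entry≡ : ∀ i j → (if does (i ≟ j) then Xpoly else []) +P constP (- adjMatrix Γ i j) ≋ charEntry g (ρ i) (ρ j)
  entry≡ i j rewrite adj≡g i j with i ≟ j
  ... | yes refl rewrite dec-true (ρ i ℕ.≟ ρ i) refl = ≋-refl
  ... | no i≢j   rewrite dec-false (ρ i ℕ.≟ ρ j) (i≢j ∘ ρ-injective) = ≋-refl

charEntry-offDiag : ∀ g {a b} → a ≢ b → charEntry g a b ≡ constP (- entry (g a b))
charEntry-offDiag g {a} {b} a≢b rewrite dec-false (a ℕ.≟ b) a≢b = refl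

charEntry-nonadjacent : ∀ g {a b} → a ≢ b → g a b ≡ none → charEntry g a b ≋ []
charEntry-nonadjacent g a≢b gab≡none rewrite charEntry-offDiag g a≢b | gab≡none = 0∷[]≋[]

edge-square : ∀ e → e ≢ none → constP (- entry e) *P constP (- entry e) ≋ 1P
edge-square none e≢none = ⊥-elim (e≢none refl)
edge-square pos  _      = ≋-refl
edge-square neg  _      = ≋-refl

module _ (low : ℕ → ℕ → Edge) where

  private
    g = symmetrize low

  charEntry-diag : ∀ a → charEntry g a a ≋ Xpoly
  charEntry-diag a rewrite symmetrize-loop low a | dec-true (a ℕ.≟ a) refl = ≋-refl

  charPolyOn-isolated : ∀ r L → All (λ z → r ≢ z × g r z ≡ none) L →
    charPolyOn g (r ∷ L) ≋ Xpoly *P charPolyOn g L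
  charPolyOn-isolated r L nonadjacent = minor-isolated (charEntry g) r L (charEntry-diag r)
    (All.map (λ (r≢z , grz≡none) → charEntry-nonadjacent g r≢z grz≡none) nonadjacent)

  charPolyOn-pendant : ∀ r L₁ y L₂ → r ≢ y → g r y ≢ none → All (λ z → r ≢ z × g r z ≡ none) (L₁ ++ L₂) →
    charPolyOn g (r ∷ L₁ ++ y ∷ L₂) ≋ Xpoly *P charPolyOn g (L₁ ++ y ∷ L₂) -P charPolyOn g (L₁ ++ L₂)
  charPolyOn-pendant r L₁ y L₂ r≢y gry≢none nonadjacent =
    minor-pendant (charEntry g) r L₁ y L₂ (charEntry-diag r)
      (All.map (λ (r≢z , grz≡none) → charEntry-nonadjacent g r≢z grz≡none
                                   , charEntry-nonadjacent g (r≢z ∘ sym) (trans (symmetrize-sym low _ r) grz≡none)) nonadjacent)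
      (subst₂ (λ p q → p *P q ≋ 1P) (sym (charEntry-offDiag g r≢y))
              (sym (trans (charEntry-offDiag g (r≢y ∘ sym)) (cong (λ e → constP (- entry e)) (symmetrize-sym low y r))))
              (edge-square (g r y) gry≢none))

-- pathPoly (1 + n) is the characteristic polynomial of the path on n vertices.
pathPoly : ℕ → Poly
pathPoly zero          = []
pathPoly (suc zero)    = 1P
pathPoly (suc (suc k)) = Xpoly *P pathPoly (suc k) -P pathPoly k

PathRecurrence : (ℕ → Poly) → Set
PathRecurrence a = ∀ k → a (2 + k) ≋ Xpoly *P a (1 + k) -P a k

private
  initial₁ : ∀ a₁ a₀ → a₁ ≋ 1P *P a₁ -P [] *P a₀
  initial₁ = solve-∀ polyRing

  initial₂ : ∀ x a₁ a₀ → x *P a₁ -P a₀ ≋ (x *P 1P -P []) *P a₁ -P 1P *P a₀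
  initial₂ = solve-∀ polyRing

  recurrence-step : ∀ x p₁ p₀ q₁ q₀ a₁ a₀ →
    x *P (p₁ *P a₁ -P p₀ *P a₀) -P (q₁ *P a₁ -P q₀ *P a₀) ≋ (x *P p₁ -P q₁) *P a₁ -P (x *P p₀ -P q₀) *P a₀
  recurrence-step = solve-∀ polyRing

pathRecurrence-solution : ∀ {a} → PathRecurrence a → ∀ k → a (1 + k) ≋ pathPoly (1 + k) *P a 1 -P pathPoly k *P a 0
pathRecurrence-solution {a} rec k = proj₁ (pair k)
  where
  open ≋-Reasoning
  solution : ℕ → Poly
  solution k = pathPoly (1 + k) *P a 1 -P pathPoly k *P a 0

  pair : ∀ k → a (1 + k) ≋ solution k × a (2 + k) ≋ solution (1 + k)
  pair zero    = initial₁ (a 1) (a 0) , ≋-trans (rec 0) (initial₂ Xpoly (a 1) (a 0))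
  pair (suc k) = let (ih₁ , ih₂) = pair k in ih₂ , (begin
    a (3 + k)                                ≈⟨ rec (1 + k) ⟩
    Xpoly *P a (2 + k) -P a (1 + k)          ≈⟨ -P-cong (*P-congʳ Xpoly ih₂) ih₁ ⟩
    Xpoly *P solution (1 + k) -P solution k
      ≈⟨ recurrence-step Xpoly (pathPoly (2 + k)) (pathPoly (1 + k)) (pathPoly (1 + k)) (pathPoly k) (a 1) (a 0) ⟩
    solution (2 + k)                         ∎)

pathPoly-+ : ∀ m n → pathPoly (1 + m + n) ≋ pathPoly (1 + m) *P pathPoly (1 + n) -P pathPoly m *P pathPoly n
pathPoly-+ m n = pathRecurrence-solution {λ k → pathPoly (k + n)} (λ _ → ≋-refl) m

private
  factor-left : ∀ a b c → b *P a -P a *P c ≋ a *P (b -P c)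
  factor-left = solve-∀ polyRing

pathPoly-double : ∀ j → pathPoly (2 + j) *P (pathPoly (3 + j) -P pathPoly (1 + j)) ≋ pathPoly (3 + j + (1 + j))
pathPoly-double j = ≋-sym (≋-trans (pathPoly-+ (2 + j) (1 + j)) (factor-left (pathPoly (2 + j)) (pathPoly (3 + j)) (pathPoly (1 + j))))

pathEdge-suc : ∀ a → pathEdge (suc a) a ≡ pos
pathEdge-suc zero    = refl
pathEdge-suc (suc a) = pathEdge-suc a

pathEdge-far : ∀ {v z} → suc z < v → pathEdge v z ≡ none
pathEdge-far {suc (suc v)} {zero}  _           = refl
pathEdge-far {suc v}       {suc z} (s≤s 2+z≤v) = pathEdge-far 2+z≤v

≡pos⇒≢none : ∀ {e} → e ≡ pos → e ≢ none
≡pos⇒≢none refl ()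

attach : Maybe ℕ → ℕ → Edge
attach nothing  z = none
attach (just y) z = if does (z ℕ.≟ y) then pos else none

attach-≡ : ∀ y → attach (just y) y ≡ pos
attach-≡ y rewrite dec-true (y ℕ.≟ y) refl = refl

attach-≢ : ∀ {y z} → y ≢ z → attach (just y) z ≡ none
attach-≢ {y} {z} y≢z rewrite dec-false (z ℕ.≟ y) (y≢z ∘ sym) = refl

-- On top of the graph `low` on the labels below e, the labels e, e + 1, e + 2, …
-- form a path whose first vertex e is joined to y, if any.
hangPath : (ℕ → ℕ → Edge) → ℕ → Maybe ℕ → ℕ → ℕ → Edge
hangPath low e y v z with <-cmp v e
... | tri< _ _ _ = low v z
... | tri≈ _ _ _ = attach y z
... | tri> _ _ _ = pathEdge v z

hangPath-below : ∀ low e y {v} z → v < e → hangPath low e y v z ≡ low v z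
hangPath-below low e y {v} z v<e with <-cmp v e
... | tri< _ _ _    = refl
... | tri≈ _ refl _ = ⊥-elim (<-irrefl refl v<e)
... | tri> _ _ e<v  = ⊥-elim (<-asym v<e e<v)

hangPath-first : ∀ low e y z → hangPath low e y e z ≡ attach y z
hangPath-first low e y z with <-cmp e e
... | tri< e<e _ _ = ⊥-elim (<-irrefl refl e<e)
... | tri≈ _ _ _   = refl
... | tri> _ _ e<e = ⊥-elim (<-irrefl refl e<e)

hangPath-above : ∀ low e y {v} z → e < v → hangPath low e y v z ≡ pathEdge v z
hangPath-above low e y {v} z e<v with <-cmp v e
... | tri< v<e _ _  = ⊥-elim (<-asym v<e e<v)
... | tri≈ _ refl _ = ⊥-elim (<-irrefl refl e<v)
... | tri> _ _ _    = refl

symmetrize-hangPath-below : ∀ low e y {a b} → a < e → b < e →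
  symmetrize (hangPath low e y) a b ≡ symmetrize low a b
symmetrize-hangPath-below low e y {a} {b} a<e b<e with <-cmp a b
... | tri< _ _ _ = hangPath-below low e y a b<e
... | tri≈ _ _ _ = refl
... | tri> _ _ _ = hangPath-below low e y b a<e

symmetrize-hangPath-first : ∀ low e y {z} → z < e → symmetrize (hangPath low e y) e z ≡ attach y z
symmetrize-hangPath-first low e y {z} z<e = trans (symmetrize-> _ z<e) (hangPath-first low e y z)

symmetrize-hangPath-above : ∀ low e y {v z} → e < v → z < v → symmetrize (hangPath low e y) v z ≡ pathEdge v z
symmetrize-hangPath-above low e y {v} {z} e<v z<v = trans (symmetrize-> _ z<v) (hangPath-above low e y z e<v)

down : ℕ → ℕ → List ℕ
down e = applyDownFrom (_+_ e)

down-++ : ∀ e m n → down e (m + n) ≡ down (e + m) n ++ down e m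
down-++ e m zero    = cong (down e) (+-identityʳ m)
down-++ e m (suc n) rewrite +-suc m n = cong₂ _∷_ (sym (+-assoc e m n)) (down-++ e m n)

down-bounds : ∀ e k → All (λ z → e ≤ z × z < e + k) (down e k)
down-bounds e zero    = []
down-bounds e (suc k) = (m≤m+n e k , +-monoʳ-< e (n<1+n k))
                      ∷ All.map (λ (e≤z , z<e+k) → e≤z , <-trans z<e+k (+-monoʳ-< e (n<1+n k))) (down-bounds e k)

module _ (low : ℕ → ℕ → Edge) (e : ℕ) (y : Maybe ℕ) where

  private
    G = symmetrize (hangPath low e y)

  charPolyOn-hangPath-below : ∀ {L} → All (_< e) L → charPolyOn G L ≋ charPolyOn (symmetrize low) L
  charPolyOn-hangPath-below L<e = minor-cong (_< e) entry≋ L<e L<e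
    where
    entry≋ : ∀ {a b} → a < e → b < e → charEntry G a b ≋ charEntry (symmetrize low) a b
    entry≋ a<e b<e rewrite symmetrize-hangPath-below low e y a<e b<e = ≋-refl

  -- The top vertex e + (1 + k) is pendant, attached to e + k.
  hangPath-recurrence : ∀ {L} → All (_< e) L → PathRecurrence (λ k → charPolyOn G (down e k ++ L))
  hangPath-recurrence {L} L<e k = charPolyOn-pendant (hangPath low e y) top [] (e + k) (down e k ++ L)
    (>⇒≢ e+k<top) (≡pos⇒≢none top~e+k)
    (All.++⁺ (All.map (λ (_ , z<e+k) → nonadjacent z<e+k) (down-bounds e k))
             (All.map (λ z<e → nonadjacent (<-≤-trans z<e (m≤m+n e k))) L<e))
    where
    top = e + suc k
    e+k<top : e + k < top
    e+k<top = +-monoʳ-< e (n<1+n k)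
    e<top : e < top
    e<top = m<m+n e (s≤s z≤n)
    top~e+k : G top (e + k) ≡ pos
    top~e+k = begin
      G top (e + k)                   ≡⟨ symmetrize-hangPath-above low e y e<top e+k<top ⟩
      pathEdge top (e + k)            ≡⟨ cong (λ v → pathEdge v (e + k)) (+-suc e k) ⟩
      pathEdge (suc (e + k)) (e + k)  ≡⟨ pathEdge-suc (e + k) ⟩
      pos                             ∎
      where open ≡-Reasoning
    nonadjacent : ∀ {z} → z < e + k → top ≢ z × G top z ≡ none
    nonadjacent {z} z<e+k = >⇒≢ (<-trans z<e+k e+k<top)
      , trans (symmetrize-hangPath-above low e y e<top (<-trans z<e+k e+k<top)) (pathEdge-far 1+z<top)
      where
      1+z<top : suc z < top
      1+z<top = subst (suc z <_) (sym (+-suc e k)) (s≤s z<e+k)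

private
  p*[x*a]-q*a≋[x*p-q]*a : ∀ x p q a → p *P (x *P a) -P q *P a ≋ (x *P p -P q) *P a
  p*[x*a]-q*a≋[x*p-q]*a = solve-∀ polyRing

  p*[x*b-c]-q*b≋[x*p-q]*b-p*c : ∀ x p q b c → p *P (x *P b -P c) -P q *P b ≋ (x *P p -P q) *P b -P p *P c
  p*[x*b-c]-q*b≋[x*p-q]*b-p*c = solve-∀ polyRing

  a≋1*a : ∀ a → a ≋ 1P *P a
  a≋1*a = solve-∀ polyRing

  a≋1*a-0*c : ∀ a c → a ≋ 1P *P a -P [] *P c
  a≋1*a-0*c = solve-∀ polyRing

charPolyOn-hangPath-isolated : ∀ low e k {L} → All (_< e) L →
  charPolyOn (symmetrize (hangPath low e nothing)) (down e k ++ L) ≋ pathPoly (1 + k) *P charPolyOn (symmetrize low) L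
charPolyOn-hangPath-isolated low e zero    L<e = ≋-trans (charPolyOn-hangPath-below low e nothing L<e) (a≋1*a _)
charPolyOn-hangPath-isolated low e (suc k) {L} L<e = begin
  a (1 + k)                                         ≈⟨ pathRecurrence-solution {a} (hangPath-recurrence low e nothing L<e) k ⟩
  pathPoly (1 + k) *P a 1 -P pathPoly k *P a 0      ≈⟨ -P-cong (*P-congʳ (pathPoly (1 + k)) first-isolated) ≋-refl ⟩
  pathPoly (1 + k) *P (Xpoly *P a 0) -P pathPoly k *P a 0
                                                    ≈⟨ p*[x*a]-q*a≋[x*p-q]*a Xpoly (pathPoly (1 + k)) (pathPoly k) (a 0) ⟩
  pathPoly (2 + k) *P a 0                           ≈⟨ *P-congʳ (pathPoly (2 + k)) (charPolyOn-hangPath-below low e nothing L<e) ⟩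
  pathPoly (2 + k) *P charPolyOn (symmetrize low) L ∎
  where
  open ≋-Reasoning
  G = symmetrize (hangPath low e nothing)
  a : ℕ → Poly
  a k = charPolyOn G (down e k ++ L)
  first-isolated : charPolyOn G (e + 0 ∷ L) ≋ Xpoly *P a 0
  first-isolated rewrite +-identityʳ e = charPolyOn-isolated (hangPath low e nothing) e L
    (All.map (λ z<e → >⇒≢ z<e , symmetrize-hangPath-first low e nothing z<e) L<e)

charPolyOn-hangPath : ∀ low e y k L₁ L₂ → All (_< e) (L₁ ++ y ∷ L₂) → All (y ≢_) (L₁ ++ L₂) →
  charPolyOn (symmetrize (hangPath low e (just y))) (down e k ++ L₁ ++ y ∷ L₂)
    ≋ pathPoly (1 + k) *P charPolyOn (symmetrize low) (L₁ ++ y ∷ L₂) -P pathPoly k *P charPolyOn (symmetrize low) (L₁ ++ L₂)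
charPolyOn-hangPath low e y zero    L₁ L₂ L<e _ =
  ≋-trans (charPolyOn-hangPath-below low e (just y) L<e) (a≋1*a-0*c _ (charPolyOn (symmetrize low) (L₁ ++ L₂)))
charPolyOn-hangPath low e y (suc k) L₁ L₂ L<e y∉L′ = begin
  a (1 + k)                                         ≈⟨ pathRecurrence-solution {a} (hangPath-recurrence low e (just y) L<e) k ⟩
  pathPoly (1 + k) *P a 1 -P pathPoly k *P a 0      ≈⟨ -P-cong (*P-congʳ (pathPoly (1 + k)) first-pendant) ≋-refl ⟩
  pathPoly (1 + k) *P (Xpoly *P a 0 -P charPolyOn G L′) -P pathPoly k *P a 0
    ≈⟨ p*[x*b-c]-q*b≋[x*p-q]*b-p*c Xpoly (pathPoly (1 + k)) (pathPoly k) (a 0) (charPolyOn G L′) ⟩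
  pathPoly (2 + k) *P a 0 -P pathPoly (1 + k) *P charPolyOn G L′
    ≈⟨ -P-cong (*P-congʳ (pathPoly (2 + k)) (charPolyOn-hangPath-below low e (just y) L<e))
               (*P-congʳ (pathPoly (1 + k)) (charPolyOn-hangPath-below low e (just y) L′<e)) ⟩
  pathPoly (2 + k) *P charPolyOn (symmetrize low) (L₁ ++ y ∷ L₂) -P pathPoly (1 + k) *P charPolyOn (symmetrize low) L′ ∎
  where
  open ≋-Reasoning
  G = symmetrize (hangPath low e (just y))
  L′ = L₁ ++ L₂
  a : ℕ → Poly
  a k = charPolyOn G (down e k ++ L₁ ++ y ∷ L₂)
  y<e : y < e
  y<e = All.head (All.++⁻ʳ L₁ L<e)
  L′<e : All (_< e) L′
  L′<e = All.++⁺ (All.++⁻ˡ L₁ L<e) (All.tail (All.++⁻ʳ L₁ L<e))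
  first-pendant : charPolyOn G (e + 0 ∷ L₁ ++ y ∷ L₂) ≋ Xpoly *P a 0 -P charPolyOn G L′
  first-pendant rewrite +-identityʳ e = charPolyOn-pendant (hangPath low e (just y)) e L₁ y L₂ (>⇒≢ y<e)
    (≡pos⇒≢none (trans (symmetrize-hangPath-first low e (just y) y<e) (attach-≡ y)))
    (All.zipWith (λ (z<e , y≢z) → >⇒≢ z<e , trans (symmetrize-hangPath-first low e (just y) z<e) (attach-≢ y≢z))
                 (L′<e , y∉L′))

x+a≡y+b⇒∣x-y∣≡∣a-b∣ : ∀ x y a b → x + a ≡ y + b → ∣ x - y ∣ ≡ ∣ a - b ∣
x+a≡y+b⇒∣x-y∣≡∣a-b∣ x y a b x+a≡y+b = begin
  ∣ x - y ∣                  ≡⟨ ∣m+n-m+o∣≡∣n-o∣ (a + b) x y ⟨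
  ∣ a + b + x - a + b + y ∣  ≡⟨ cong₂ ∣_-_∣ (shuffle₁ a b x) (trans (shuffle₂ a b y) (cong (_+ a) (sym x+a≡y+b))) ⟩
  ∣ x + a + b - x + a + a ∣  ≡⟨ ∣m+n-m+o∣≡∣n-o∣ (x + a) b a ⟩
  ∣ b - a ∣                  ≡⟨ ∣-∣-comm b a ⟩
  ∣ a - b ∣                  ∎
  where
  open ≡-Reasoning
  shuffle₁ : ∀ a b x → a + b + x ≡ x + a + b
  shuffle₁ = ℕ-Solver.solve-∀
  shuffle₂ : ∀ a b y → a + b + y ≡ y + b + a
  shuffle₂ = ℕ-Solver.solve-∀

-- Vertex i of a graph on Fin n gets the label n - 1 - i: det expands along
-- the first vertex, and hanging paths are removed from their highest label.
reversed : ∀ {n} → Fin n → ℕ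
reversed = toℕ ∘ opposite

reversed-injective : ∀ {n} {i j : Fin n} → reversed i ≡ reversed j → i ≡ j
reversed-injective {i = i} {j} eq =
  trans (sym (opposite-involutive i)) (trans (cong opposite (toℕ-injective eq)) (opposite-involutive j))

tabulate-reversed : ∀ n → tabulate (reversed {n}) ≡ down 0 n
tabulate-reversed zero    = refl
tabulate-reversed (suc n) = cong₂ _∷_ (toℕ-fromℕ n) (trans (tabulate-cong opposite-suc) (tabulate-reversed n))

pathEdge-reversed : ∀ {n} (i j : Fin n) → pathEdge (reversed i) (reversed j) ≡ pathEdge (toℕ i) (toℕ j)
pathEdge-reversed i j = cong edgeOfDist
  (x+a≡y+b⇒∣x-y∣≡∣a-b∣ (reversed i) (reversed j) (suc (toℕ i)) (suc (toℕ j)) (trans (reversed+ i) (sym (reversed+ j))))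
  where
  reversed+ : ∀ {n} (i : Fin n) → reversed i + suc (toℕ i) ≡ n
  reversed+ i = trans (cong (_+ suc (toℕ i)) (opposite-prop i)) (m∸n+n≡m (toℕ<n i))

pathEdge-hangPath : ∀ low a b → pathEdge a b ≡ symmetrize (hangPath low 0 nothing) a b
pathEdge-hangPath low a b with <-cmp a b
... | tri< a<b _ _  = trans (pathEdge-sym a b) (sym (hangPath-above low 0 nothing a (≤-<-trans z≤n a<b)))
... | tri≈ _ refl _ = pathEdge-loop a
... | tri> _ _ b<a  = sym (hangPath-above low 0 nothing b (≤-<-trans z≤n b<a))

charPoly-path : ∀ n → charPoly (path n) ≋ pathPoly (1 + n)
charPoly-path n = begin
  charPoly (path n)                       ≈⟨ charPoly-≋-charPolyOn (path n) g (reversed {n}) reversed-injective adj≡ ⟩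
  charPolyOn g (tabulate (reversed {n}))  ≡⟨ cong (charPolyOn g) (trans (tabulate-reversed n) (sym (++-identityʳ (down 0 n)))) ⟩
  charPolyOn g (down 0 n ++ [])           ≈⟨ charPolyOn-hangPath-isolated noEdges 0 n [] ⟩
  pathPoly (1 + n) *P 1P                  ≈⟨ *P-comm (pathPoly (1 + n)) 1P ⟩
  1P *P pathPoly (1 + n)                  ≈⟨ *P-identityˡ (pathPoly (1 + n)) ⟩
  pathPoly (1 + n)                        ∎
  where
  open ≋-Reasoning
  noEdges : ℕ → ℕ → Edge
  noEdges _ _ = none
  g = symmetrize (hangPath noEdges 0 nothing)
  adj≡ : ∀ (i j : Fin n) → pathEdge (toℕ i) (toℕ j) ≡ g (reversed i) (reversed j)
  adj≡ i j = trans (sym (pathEdge-reversed i j)) (pathEdge-hangPath noEdges (reversed i) (reversed j))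

Consecutive : ℕ → ℕ → Set
Consecutive a b = b ≡ suc a ⊎ a ≡ suc b

pathEdge-consecutive : ∀ a b → pathEdge a b ≢ none → Consecutive a b
pathEdge-consecutive a b edge≢none = ∣-∣≡1⇒consecutive a b (edgeOfDist≢none ∣ a - b ∣ edge≢none)
  where
  edgeOfDist≢none : ∀ d → edgeOfDist d ≢ none → d ≡ 1
  edgeOfDist≢none d e≢none with d ℕ.≟ 1
  ... | yes d≡1 = d≡1
  ... | no  _   = ⊥-elim (e≢none refl)
  ∣-∣≡1⇒consecutive : ∀ a b → ∣ a - b ∣ ≡ 1 → Consecutive a b
  ∣-∣≡1⇒consecutive zero    b       eq = inj₁ eq
  ∣-∣≡1⇒consecutive (suc a) zero    eq = inj₂ eq
  ∣-∣≡1⇒consecutive (suc a) (suc b) eq with ∣-∣≡1⇒consecutive a b eq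
  ... | inj₁ b≡1+a = inj₁ (cong suc b≡1+a)
  ... | inj₂ a≡1+b = inj₂ (cong suc a≡1+b)

consecutive-pigeonhole : ∀ {a b₁ b₂ b₃} → Consecutive a b₁ → Consecutive a b₂ → Consecutive a b₃ →
  b₁ ≡ b₂ ⊎ b₁ ≡ b₃ ⊎ b₂ ≡ b₃
consecutive-pigeonhole (inj₁ p) (inj₁ q) _        = inj₁ (trans p (sym q))
consecutive-pigeonhole (inj₂ p) (inj₂ q) _        = inj₁ (suc-injective (trans (sym p) q))
consecutive-pigeonhole (inj₁ p) (inj₂ _) (inj₁ r) = inj₂ (inj₁ (trans p (sym r)))
consecutive-pigeonhole (inj₁ _) (inj₂ q) (inj₂ r) = inj₂ (inj₂ (suc-injective (trans (sym q) r)))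
consecutive-pigeonhole (inj₂ _) (inj₁ q) (inj₁ r) = inj₂ (inj₂ (trans q (sym r)))
consecutive-pigeonhole (inj₂ p) (inj₁ _) (inj₂ r) = inj₂ (inj₁ (suc-injective (trans (sym p) r)))

flipIf-≢none : ∀ s e → flipIf s e ≢ none → e ≢ none
flipIf-≢none true  none flipped≢none = λ _ → flipped≢none refl
flipIf-≢none false none flipped≢none = λ _ → flipped≢none refl
flipIf-≢none s     pos  _            = λ ()
flipIf-≢none s     neg  _            = λ ()

-- Switching isomorphisms preserve degrees, and no vertex of a path has degree 3.
¬switchingIsomorphic-path : ∀ {n} (Δ : SignedGraph n) x {a b c} → a ≢ b → a ≢ c → b ≢ c →
  adj Δ x a ≢ none → adj Δ x b ≢ none → adj Δ x c ≢ none → ¬ SwitchingIsomorphic (path n) Δ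
¬switchingIsomorphic-path Δ x a≢b a≢c b≢c x~a x~b x~c (X , π , adj≡) =
  [ a≢b ∘ distinct , [ a≢c ∘ distinct , b≢c ∘ distinct ]′ ]′
    (consecutive-pigeonhole (consecutive x~a) (consecutive x~b) (consecutive x~c))
  where
  open Inverse π
  consecutive : ∀ {w} → adj Δ x w ≢ none → Consecutive (toℕ (from x)) (toℕ (from w))
  consecutive {w} x~w = pathEdge-consecutive _ _ (flipIf-≢none (X (from x) xor X (from w)) _ λ switched≡none →
    x~w (trans (sym (cong₂ (adj Δ) (strictlyInverseˡ x) (strictlyInverseˡ w))) (trans (adj≡ (from x) (from w)) switched≡none)))
  distinct : ∀ {v w} → toℕ (from v) ≡ toℕ (from w) → v ≡ w
  distinct {v} {w} eq = trans (sym (strictlyInverseˡ v)) (trans (cong to (toℕ-injective eq)) (strictlyInverseˡ w))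

quadrangle : ℕ → ℕ → Edge
quadrangle 1 0 = pos
quadrangle 2 1 = pos
quadrangle 3 2 = pos
quadrangle 3 0 = neg
quadrangle _ _ = none

X²-2 : Poly
X²-2 = Xpoly *P Xpoly -P constP (+ 2)

charPolyOn-quadrangle : charPolyOn (symmetrize quadrangle) (3 ∷ 2 ∷ 1 ∷ 0 ∷ []) ≋ X²-2 *P X²-2
charPolyOn-quadrangle = ≈P⇒≋ refl

charPolyOn-quadrangle∖3 : charPolyOn (symmetrize quadrangle) (2 ∷ 1 ∷ 0 ∷ []) ≋ Xpoly *P X²-2
charPolyOn-quadrangle∖3 = ≈P⇒≋ refl

charPolyOn-quadrangle∖1 : charPolyOn (symmetrize quadrangle) (3 ∷ 2 ∷ 0 ∷ []) ≋ Xpoly *P X²-2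
charPolyOn-quadrangle∖1 = ≈P⇒≋ refl

charPolyOn-quadrangle∖13 : charPolyOn (symmetrize quadrangle) (2 ∷ 0 ∷ []) ≋ Xpoly *P Xpoly
charPolyOn-quadrangle∖13 = ≈P⇒≋ refl

private
  quadrangle-step : ∀ x p₁ p₀ → (x *P x -P constP (+ 2)) *P p₁ -P x *P p₀ ≋ (x *P (x *P p₁ -P p₀) -P p₁) -P p₁
  quadrangle-step = solve-∀ polyRing

  factorise : ∀ x p q r a b → let c = x *P x -P constP (+ 2) in
    p *P (q *P (a *P (c *P c) -P b *P (x *P c)) -P r *P (a *P (x *P c) -P b *P (x *P x)))
      ≋ (p *P (c *P a -P x *P b)) *P (c *P q -P x *P r)
  factorise = solve-∀ polyRing

X²-2-pathPoly : ∀ j → X²-2 *P pathPoly (1 + j) -P Xpoly *P pathPoly j ≋ pathPoly (3 + j) -P pathPoly (1 + j)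
X²-2-pathPoly j = quadrangle-step Xpoly (pathPoly (1 + j)) (pathPoly j)

-- A path with t vertices hanging from the vertex 3 of the quadrangle, a path
-- with 2t + 2 vertices hanging from the opposite vertex 1, and a disjoint path
-- with t + 1 vertices.
module _ (t : ℕ) where

  shortPathStart longPathStart isolatedPathStart mateOrder : ℕ
  shortPathStart    = 4
  longPathStart     = 4 + t
  isolatedPathStart = longPathStart + (2 + (t + t))
  mateOrder         = isolatedPathStart + (1 + t)

  withShortPath withLongPath mateLow : ℕ → ℕ → Edge
  withShortPath = hangPath quadrangle shortPathStart (just 3)
  withLongPath  = hangPath withShortPath longPathStart (just 1)
  mateLow       = hangPath withLongPath isolatedPathStart nothing

  mate : SignedGraph mateOrder
  mate = record
    { adj      = λ i j → symmetrize mateLow (reversed i) (reversed j)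
    ; adj-sym  = λ i j → symmetrize-sym mateLow (reversed i) (reversed j)
    ; loopless = λ i → symmetrize-loop mateLow (reversed i)
    }

  private
    C = X²-2

  charPolyOn-withShortPath : charPolyOn (symmetrize withShortPath) (down 4 t ++ 3 ∷ 2 ∷ 1 ∷ 0 ∷ [])
    ≋ pathPoly (1 + t) *P (C *P C) -P pathPoly t *P (Xpoly *P C)
  charPolyOn-withShortPath =
    ≋-trans (charPolyOn-hangPath quadrangle 4 3 t [] (2 ∷ 1 ∷ 0 ∷ []) below ((λ ()) ∷ (λ ()) ∷ (λ ()) ∷ []))
            (-P-cong (*P-congʳ (pathPoly (1 + t)) charPolyOn-quadrangle) (*P-congʳ (pathPoly t) charPolyOn-quadrangle∖3))
    where
    below = s≤s (s≤s (s≤s (s≤s z≤n))) ∷ s≤s (s≤s (s≤s z≤n)) ∷ s≤s (s≤s z≤n) ∷ s≤s z≤n ∷ []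

  charPolyOn-withShortPath∖1 : charPolyOn (symmetrize withShortPath) (down 4 t ++ 3 ∷ 2 ∷ 0 ∷ [])
    ≋ pathPoly (1 + t) *P (Xpoly *P C) -P pathPoly t *P (Xpoly *P Xpoly)
  charPolyOn-withShortPath∖1 =
    ≋-trans (charPolyOn-hangPath quadrangle 4 3 t [] (2 ∷ 0 ∷ []) below ((λ ()) ∷ (λ ()) ∷ []))
            (-P-cong (*P-congʳ (pathPoly (1 + t)) charPolyOn-quadrangle∖1) (*P-congʳ (pathPoly t) charPolyOn-quadrangle∖13))
    where
    below = s≤s (s≤s (s≤s (s≤s z≤n))) ∷ s≤s (s≤s (s≤s z≤n)) ∷ s≤s z≤n ∷ []

  charPolyOn-withLongPath : charPolyOn (symmetrize withLongPath) (down 0 isolatedPathStart)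
    ≋ pathPoly (3 + (t + t)) *P charPolyOn (symmetrize withShortPath) (down 4 t ++ 3 ∷ 2 ∷ 1 ∷ 0 ∷ [])
      -P pathPoly (2 + (t + t)) *P charPolyOn (symmetrize withShortPath) (down 4 t ++ 3 ∷ 2 ∷ 0 ∷ [])
  charPolyOn-withLongPath = begin
    charPolyOn (symmetrize withLongPath) (down 0 isolatedPathStart)
      ≡⟨ cong (charPolyOn (symmetrize withLongPath)) split ⟩
    charPolyOn (symmetrize withLongPath) (down longPathStart (2 + (t + t)) ++ L₁ ++ 1 ∷ 0 ∷ [])
      ≈⟨ charPolyOn-hangPath withShortPath longPathStart 1 (2 + (t + t)) L₁ (0 ∷ []) below 1∉ ⟩
    pathPoly (3 + (t + t)) *P charPolyOn (symmetrize withShortPath) (L₁ ++ 1 ∷ 0 ∷ [])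
      -P pathPoly (2 + (t + t)) *P charPolyOn (symmetrize withShortPath) (L₁ ++ 0 ∷ [])
      ≡⟨ cong₂ (λ L L′ → pathPoly (3 + (t + t)) *P charPolyOn (symmetrize withShortPath) L
                        -P pathPoly (2 + (t + t)) *P charPolyOn (symmetrize withShortPath) L′)
               (++-assoc (down 4 t) _ _) (++-assoc (down 4 t) _ _) ⟩
    pathPoly (3 + (t + t)) *P charPolyOn (symmetrize withShortPath) (down 4 t ++ 3 ∷ 2 ∷ 1 ∷ 0 ∷ [])
      -P pathPoly (2 + (t + t)) *P charPolyOn (symmetrize withShortPath) (down 4 t ++ 3 ∷ 2 ∷ 0 ∷ [])
      ∎
    where
    open ≋-Reasoning
    L₁ = down 4 t ++ 3 ∷ 2 ∷ []
    split : down 0 isolatedPathStart ≡ down longPathStart (2 + (t + t)) ++ L₁ ++ 1 ∷ 0 ∷ []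
    split = trans (down-++ 0 longPathStart (2 + (t + t)))
                  (cong (down longPathStart (2 + (t + t)) ++_) (trans (down-++ 0 4 t) (sym (++-assoc (down 4 t) _ _))))
    shortBounds = down-bounds 4 t
    below : All (_< longPathStart) (L₁ ++ 1 ∷ 0 ∷ [])
    below = All.++⁺ (All.++⁺ (All.map proj₂ shortBounds) (s≤s (s≤s (s≤s (s≤s z≤n))) ∷ s≤s (s≤s (s≤s z≤n)) ∷ []))
                    (s≤s (s≤s z≤n) ∷ s≤s z≤n ∷ [])
    1∉ : All (1 ≢_) (L₁ ++ 0 ∷ [])
    1∉ = All.++⁺ (All.++⁺ (All.map (λ (4≤z , _) → <⇒≢ (≤-trans (s≤s (s≤s z≤n)) 4≤z)) shortBounds) ((λ ()) ∷ (λ ()) ∷ []))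
                 ((λ ()) ∷ [])

  charPoly-mate : charPoly mate ≋ pathPoly (1 + mateOrder)
  charPoly-mate = begin
    charPoly mate
      ≈⟨ charPoly-≋-charPolyOn mate G reversed reversed-injective (λ _ _ → refl) ⟩
    charPolyOn G (tabulate (reversed {mateOrder}))
      ≡⟨ cong (charPolyOn G) (trans (tabulate-reversed mateOrder) (down-++ 0 isolatedPathStart (1 + t))) ⟩
    charPolyOn G (down isolatedPathStart (1 + t) ++ down 0 isolatedPathStart)
      ≈⟨ charPolyOn-hangPath-isolated withLongPath isolatedPathStart (1 + t) (All.map proj₂ (down-bounds 0 isolatedPathStart)) ⟩
    pathPoly (2 + t) *P charPolyOn (symmetrize withLongPath) (down 0 isolatedPathStart)
      ≈⟨ *P-congʳ (pathPoly (2 + t)) (≋-trans charPolyOn-withLongPath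
           (-P-cong (*P-congʳ (pathPoly (3 + j)) charPolyOn-withShortPath) (*P-congʳ (pathPoly (2 + j)) charPolyOn-withShortPath∖1))) ⟩
    pathPoly (2 + t) *P (pathPoly (3 + j) *P (pathPoly (1 + t) *P (X²-2 *P X²-2) -P pathPoly t *P (Xpoly *P X²-2))
                         -P pathPoly (2 + j) *P (pathPoly (1 + t) *P (Xpoly *P X²-2) -P pathPoly t *P (Xpoly *P Xpoly)))
      ≈⟨ factorise Xpoly (pathPoly (2 + t)) (pathPoly (3 + j)) (pathPoly (2 + j)) (pathPoly (1 + t)) (pathPoly t) ⟩
    (pathPoly (2 + t) *P (X²-2 *P pathPoly (1 + t) -P Xpoly *P pathPoly t)) *P (X²-2 *P pathPoly (3 + j) -P Xpoly *P pathPoly (2 + j))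
      ≈⟨ *P-cong (≋-trans (*P-congʳ (pathPoly (2 + t)) (X²-2-pathPoly t)) (pathPoly-double t)) (X²-2-pathPoly (2 + j)) ⟩
    pathPoly (3 + t + (1 + t)) *P (pathPoly (3 + (2 + j)) -P pathPoly (1 + (2 + j)))
      ≡⟨ cong (λ m → pathPoly m *P (pathPoly (3 + (2 + j)) -P pathPoly (1 + (2 + j)))) (double-t t) ⟩
    pathPoly (2 + (2 + j)) *P (pathPoly (3 + (2 + j)) -P pathPoly (1 + (2 + j)))
      ≈⟨ pathPoly-double (2 + j) ⟩
    pathPoly (3 + (2 + j) + (1 + (2 + j)))
      ≡⟨ cong pathPoly (double-j t) ⟩
    pathPoly (1 + mateOrder)
      ∎
    where
    open ≋-Reasoning
    G = symmetrize mateLow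
    j = t + t
    double-t : ∀ t → 3 + t + (1 + t) ≡ 2 + (2 + (t + t))
    double-t = ℕ-Solver.solve-∀
    double-j : ∀ t → 3 + (2 + (t + t)) + (1 + (2 + (t + t))) ≡ 1 + ((4 + t + (2 + (t + t))) + (1 + t))
    double-j = ℕ-Solver.solve-∀

  vertex : ∀ {l} → l < mateOrder → Fin mateOrder
  vertex l<N = opposite (fromℕ< l<N)

  reversed-vertex : ∀ {l} (l<N : l < mateOrder) → reversed (vertex l<N) ≡ l
  reversed-vertex l<N = trans (cong toℕ (opposite-involutive (fromℕ< l<N))) (toℕ-fromℕ< l<N)

  mate-adj : ∀ {l m} (l<N : l < mateOrder) (m<N : m < mateOrder) →
    adj mate (vertex l<N) (vertex m<N) ≡ symmetrize mateLow l m
  mate-adj l<N m<N = cong₂ (symmetrize mateLow) (reversed-vertex l<N) (reversed-vertex m<N)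

  -- The vertex 1 has the neighbours 0, 2 and longPathStart.
  ¬switchingIsomorphic-mate : ¬ SwitchingIsomorphic (path mateOrder) mate
  ¬switchingIsomorphic-mate = ¬switchingIsomorphic-path mate (vertex 1<N)
    (0≢2 ∘ vertex-injective 0<N 2<N) (0≢s ∘ vertex-injective 0<N s<N) (2≢s ∘ vertex-injective 2<N s<N)
    (≡pos⇒≢none (mate-adj 1<N 0<N)) (≡pos⇒≢none (mate-adj 1<N 2<N)) (≡pos⇒≢none (trans (mate-adj 1<N s<N) 1~s))
    where
    N = mateOrder
    s = longPathStart
    0<N : 0 < N
    0<N = s≤s z≤n
    1<N : 1 < N
    1<N = s≤s (s≤s z≤n)
    2<N : 2 < N
    2<N = s≤s (s≤s (s≤s z≤n))
    s<N : s < N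
    s<N = <-≤-trans (m<m+n s (s≤s z≤n)) (m≤m+n isolatedPathStart (1 + t))
    vertex-injective : ∀ {l m} (l<N : l < N) (m<N : m < N) → vertex l<N ≡ vertex m<N → l ≡ m
    vertex-injective l<N m<N eq = trans (sym (reversed-vertex l<N)) (trans (cong reversed eq) (reversed-vertex m<N))
    0≢2 : 0 ≢ 2
    0≢2 ()
    0≢s : 0 ≢ s
    0≢s ()
    2≢s : 2 ≢ s
    2≢s ()
    1~s : symmetrize mateLow 1 s ≡ pos
    1~s = trans (hangPath-below withLongPath isolatedPathStart nothing 1 (m<m+n s (s≤s z≤n)))
                (hangPath-first withShortPath s (just 1) 1)

cospectral-mate : ∀ t → Cospectral (path (mateOrder t)) (mate t)
cospectral-mate t = ≋⇒≈P (≋-trans (charPoly-path (mateOrder t)) (≋-sym (charPoly-mate t)))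

_≟ᴱ_ : DecidableEquality Edge
none ≟ᴱ none = yes refl
pos  ≟ᴱ pos  = yes refl
neg  ≟ᴱ neg  = yes refl
none ≟ᴱ pos  = no λ ()
none ≟ᴱ neg  = no λ ()
pos  ≟ᴱ none = no λ ()
pos  ≟ᴱ neg  = no λ ()
neg  ≟ᴱ none = no λ ()
neg  ≟ᴱ pos  = no λ ()

det-cong : ∀ {n} {M N : Fin n → Fin n → Poly} → (∀ i j → M i j ≡ N i j) → det M ≡ det N
det-cong {zero}  M≡N = refl
det-cong {suc n} M≡N = cong sumP (map-cong (λ j →
  cong₂ (λ m d → constP (signℕ (toℕ j)) *P m *P d) (M≡N zero j) (det-cong λ i k → M≡N (suc i) (punchIn j k))) (allFinL _))

charPolyOfAdj : ∀ {n} → (Fin n → Fin n → Edge) → Poly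
charPolyOfAdj A = det λ i j → (if does (i ≟ j) then Xpoly else []) +P constP (- entry (A i j))

charPolyOfAdj-cong : ∀ {n} {A B : Fin n → Fin n → Edge} → (∀ i j → A i j ≡ B i j) → charPolyOfAdj A ≡ charPolyOfAdj B
charPolyOfAdj-cong A≡B = det-cong λ i j → cong (λ e → _ +P constP (- entry e)) (A≡B i j)

triangle : Edge → Edge → Edge → Fin 3 → Fin 3 → Edge
triangle a b c zero             (suc zero)       = a
triangle a b c zero             (suc (suc zero)) = b
triangle a b c (suc zero)       zero             = a
triangle a b c (suc zero)       (suc (suc zero)) = c
triangle a b c (suc (suc zero)) zero             = b
triangle a b c (suc (suc zero)) (suc zero)       = c
triangle a b c _                _                = none

adj≡triangle : (Γ : SignedGraph 3) → ∀ i j →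
  adj Γ i j ≡ triangle (adj Γ zero (suc zero)) (adj Γ zero (suc (suc zero))) (adj Γ (suc zero) (suc (suc zero))) i j
adj≡triangle Γ zero             zero             = loopless Γ zero
adj≡triangle Γ zero             (suc zero)       = refl
adj≡triangle Γ zero             (suc (suc zero)) = refl
adj≡triangle Γ (suc zero)       zero             = adj-sym Γ _ _
adj≡triangle Γ (suc zero)       (suc zero)       = loopless Γ _
adj≡triangle Γ (suc zero)       (suc (suc zero)) = refl
adj≡triangle Γ (suc (suc zero)) zero             = adj-sym Γ _ _
adj≡triangle Γ (suc (suc zero)) (suc zero)       = adj-sym Γ _ _
adj≡triangle Γ (suc (suc zero)) (suc (suc zero)) = loopless Γ _

IsSwitchingIso : (Fin 3 → Fin 3 → Edge) → (Fin 3 → Bool) → Fin 3 ↔ Fin 3 → Set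
IsSwitchingIso A X π = ∀ i j → A (Inverse.to π i) (Inverse.to π j) ≡ switchAdj X (path 3) i j

isSwitchingIso? : ∀ A X π → Dec (IsSwitchingIso A X π)
isSwitchingIso? A X π = all? λ i → all? λ j → A (Inverse.to π i) (Inverse.to π j) ≟ᴱ switchAdj X (path 3) i j

-- Every signed path on three vertices arises from P₃ by switching at some of
-- its ends and then moving its middle vertex.
candidates : List ((Fin 3 → Bool) × (Fin 3 ↔ Fin 3))
candidates = cartesianProduct (ends false false ∷ ends false true ∷ ends true false ∷ ends true true ∷ [])
                              (Permutation.id ∷ Permutation.transpose zero (suc zero)
                                              ∷ Permutation.transpose (suc zero) (suc (suc zero)) ∷ [])
  where
  ends : Bool → Bool → Fin 3 → Bool
  ends x₀ x₂ zero             = x₀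
  ends x₀ x₂ (suc zero)       = false
  ends x₀ x₂ (suc (suc zero)) = x₂

candidateSwitchingIso? : ∀ A → Dec (Any (λ (X , π) → IsSwitchingIso A X π) candidates)
candidateSwitchingIso? A = any? (λ (X , π) → isSwitchingIso? A X π) candidates

candidateSwitchingIso-found : ∀ a b c → charPoly (path 3) ≈P charPolyOfAdj (triangle a b c) →
  True (candidateSwitchingIso? (triangle a b c))
candidateSwitchingIso-found none none none ()
candidateSwitchingIso-found none none pos  ()
candidateSwitchingIso-found none none neg  ()
candidateSwitchingIso-found none pos  none ()
candidateSwitchingIso-found none pos  pos  _ = _
candidateSwitchingIso-found none pos  neg  _ = _
candidateSwitchingIso-found none neg  none ()
candidateSwitchingIso-found none neg  pos  _ = _
candidateSwitchingIso-found none neg  neg  _ = _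
candidateSwitchingIso-found pos  none none ()
candidateSwitchingIso-found pos  none pos  _ = _
candidateSwitchingIso-found pos  none neg  _ = _
candidateSwitchingIso-found pos  pos  none _ = _
candidateSwitchingIso-found pos  pos  pos  ()
candidateSwitchingIso-found pos  pos  neg  ()
candidateSwitchingIso-found pos  neg  none _ = _
candidateSwitchingIso-found pos  neg  pos  ()
candidateSwitchingIso-found pos  neg  neg  ()
candidateSwitchingIso-found neg  none none ()
candidateSwitchingIso-found neg  none pos  _ = _
candidateSwitchingIso-found neg  none neg  _ = _
candidateSwitchingIso-found neg  pos  none _ = _
candidateSwitchingIso-found neg  pos  pos  ()
candidateSwitchingIso-found neg  pos  neg  ()
candidateSwitchingIso-found neg  neg  none _ = _
candidateSwitchingIso-found neg  neg  pos  ()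
candidateSwitchingIso-found neg  neg  neg  ()

path3-determinedBySpectrum : DeterminedBySpectrum (path 3)
path3-determinedBySpectrum Γ cospectral =
  let ((X , π) , iso) = satisfied (toWitness (candidateSwitchingIso-found a b c cospectral′)) in
  X , π , λ i j → trans (adj≡triangle Γ _ _) (iso i j)
  where
  a = adj Γ zero (suc zero)
  b = adj Γ zero (suc (suc zero))
  c = adj Γ (suc zero) (suc (suc zero))
  cospectral′ : charPoly (path 3) ≈P charPolyOfAdj (triangle a b c)
  cospectral′ = trans cospectral (cong normP (charPolyOfAdj-cong (adj≡triangle Γ)))

mod4≡3-cases : ∀ n → n % 4 ≡ 3 → n ≡ 3 ⊎ Σ ℕ λ t → n ≡ mateOrder t
mod4≡3-cases n n%4≡3 with n / 4 | m≡m%n+[m/n]*n n 4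
... | zero  | n≡ = inj₁ (trans n≡ (cong (_+ 0) n%4≡3))
... | suc t | n≡ = inj₂ (t , trans n≡ (trans (cong (_+ suc t * 4) n%4≡3) (4t+7 t)))
  where
  4t+7 : ∀ t → 3 + suc t * 4 ≡ 4 + t + (2 + (t + t)) + (1 + t)
  4t+7 = ℕ-Solver.solve-∀

corollary5p3 : (n : ℕ) → n % 4 ≡ 3 →
    (DeterminedBySpectrum (path n) ⇔ n ≡ 3)
corollary5p3 n n%4≡3 = mk⇔ onlyThree three
  where
  onlyThree : DeterminedBySpectrum (path n) → n ≡ 3
  onlyThree determined with mod4≡3-cases n n%4≡3
  ... | inj₁ n≡3        = n≡3
  ... | inj₂ (t , refl) = ⊥-elim (¬switchingIsomorphic-mate t (determined (mate t) (cospectral-mate t)))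
  three : n ≡ 3 → DeterminedBySpectrum (path n)
  three refl = path3-determinedBySpectrum
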